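{- Let $N,t,m,s,v,\lambda$ be positive integers. (1) If there exists an $OCA_{\lambda}(N;t,m,t-1,v)$, then there exists an $OCA_{\lambda}(N;t,m,t,v)$. (2) If there exists an $OCA_{\lambda}(N;t,m,s,v)$, then there exists an $OCA_{\lambda}(N;t,m,s-1,v)$. (3) If there exists an $OCA_{\lambda}(N;t,m,s,v)$, then there exists an $OCA_{\lambda}(N;t,m-1,s,v)$. (In each item, the parameters of both arrays are assumed to satisfy the requirements of the definition below, e.g. $2\le t\le m(t-1)$ in (1), $s\ge 2$ and $2\le t\le m(s-1)$ in (2), $m\ge 2$ and $2\le t\le (m-1)s$ in (3).)
   Context: For positive integers $m,s$, the RT poset $[m\times s]$ (Rosenbloom–Tsfasman poset) is the set $\{1,\dots,ms\}$ partitioned into $m$ blocks $B_i=\{is+1,\dots,(i+1)s\}$, $i=0,\dots,m-1$, where each block is a chain $is+1\prec is+2\prec\cdots\prec (i+1)s$ and elements of distinct blocks are incomparable. (More generally an RT poset $\Omega[m,s]$ is any poset isomorphic to this, a disjoint union of $m$ chains of $s$ elements each.) An ideal is a subset $I$ such that $b\in I$ and $a\preceq b$ imply $a\in I$; an anti-ideal is the complement of an ideal. Ordered covering array: let $t,m,s,v,\lambda,N$ be positive integers with $2\le t\le ms$. An $OCA_{\lambda}(N;t,m,s,v)$ is an $N\times ms$ array with entries from an alphabet of size $v$ whose columns are labeled by the elements of an RT poset $\Omega[m,s]$, such that for every anti-ideal $J$ with $|J|=t$, the $N\times t$ subarray formed by the columns labeled by $J$ contains every $t$-tuple over the alphabet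 as a row at least $\lambda$ times. -}

module Defs where

open import Data.Nat using (ℕ; zero; suc; _+_; _*_; _≤_)
open import Data.Fin using (Fin; zero; suc)
import Data.Fin as F
open import Data.Fin.Properties using (_≟_)
open import Data.Bool using (Bool; true; false; _∧_; _∨_; not; if_then_else_)
open import Data.Product using (Σ; _×_)
open import Relation.Binary.PropositionalEquality using (_≡_)
open import Relation.Nullary using (does)

sumᶠ : ∀ {n} → (Fin n → ℕ) → ℕ
sumᶠ {zero}  f = 0
sumᶠ {suc n} f = f zero + sumᶠ (λ i → f (suc i))

countᶠ : ∀ {n} → (Fin n → Bool) → ℕ
countᶠ p = sumᶠ (λ i → if p i then 1 else 0)

allᶠ : ∀ {n} → (Fin n → Bool) → Bool
allᶠ {zero}  p = true
allᶠ {suc n} p = p zero ∧ allᶠ (λ i → p (suc i))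

-- The RT poset [m × s]: element (i , j) : Fin m × Fin s stands for
-- i*s + (j+1), i.e. the (j+1)-th element of the chain B_i.
-- (i , j) ⪯ (i' , k)  iff  i ≡ i' and j ≤ k.
RTSubset : ℕ → ℕ → Set
RTSubset m s = Fin m → Fin s → Bool

-- anti-ideal = complement of an ideal = up-closed subset
IsAntiIdeal : ∀ {m s} → RTSubset m s → Set
IsAntiIdeal {m} {s} J =
  (i : Fin m) (j k : Fin s) → j F.≤ k → J i j ≡ true → J i k ≡ true

card : ∀ {m s} → RTSubset m s → ℕ
card J = sumᶠ (λ i → countᶠ (J i))

Array : ℕ → ℕ → ℕ → ℕ → Set
Array N m s v = Fin N → Fin m → Fin s → Fin v

agreesOn : ∀ {N m s v} → Array N m s v → RTSubset m s →
           (Fin m → Fin s → Fin v) → Fin N → Bool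
agreesOn A J f r =
  allᶠ (λ i → allᶠ (λ j → not (J i j) ∨ does (A r i j ≟ f i j)))

IsOCA : (λ' N t m s v : ℕ) → Array N m s v → Set
IsOCA λ' N t m s v A =
  (J : RTSubset m s) → IsAntiIdeal J → card J ≡ t →
  (f : Fin m → Fin s → Fin v) →
  λ' ≤ countᶠ (agreesOn A J f)

OCA : (λ' N t m s v : ℕ) → Set
OCA λ' N t m s v =
  2 ≤ t × t ≤ m * s × Σ (Array N m s v) (IsOCA λ' N t m s v)

{-# OPTIONS --safe #-}
-- Each part transfers coverage: for every anti-ideal J′ of size t of the new poset and
-- every tuple f′ on it we find an anti-ideal J of size t of the old poset and a tuple f
-- such that each old row agreeing with f on J gives a new row agreeing with f′ on J′.
-- In (2) and (3) the new array deletes the bottom of every chain, resp. a whole chain,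
-- and J′ is an anti-ideal of the old poset as it stands. In (1) every chain of length
-- t − 1 gets a new bottom whose column copies the top column of another chain. An
-- anti-ideal of size t avoiding all bottoms is an anti-ideal of the old poset; one
-- containing a bottom is a whole new chain, whose columns are an old chain plus the top
-- of another one, again an anti-ideal of size t.
module Submission where

open import Defs
open import Algebra.Properties.CommutativeSemigroup using (interchange)
open import Data.Bool using (Bool; true; false; _∧_; _∨_; not; if_then_else_)
import Data.Bool.Properties as Bool
open import Data.Fin using (Fin; zero; suc; fromℕ)
open import Data.Fin.Properties using (_≟_; any?; ≤fromℕ)
import Data.Fin.Properties as Fin
open import Data.Nat using (ℕ; zero; suc; _+_; _*_; _∸_; _≤_; z≤n; s≤s)
open import Data.Nat.Properties
  using (≤-trans; ≤-reflexive; 1+n≰n; m≤m+n; m≤n+m; +-mono-≤; +-monoʳ-≤; +-identityʳ; +-comm;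
         +-suc; *-identityˡ; *-monoʳ-≤; n≤1+n; +-commutativeSemigroup)
open import Data.Product using (Σ-syntax; _×_; _,_)
open import Function using (_∘_)
open import Relation.Binary.PropositionalEquality
  using (_≡_; _≢_; refl; sym; trans; cong; cong₂; subst)
open import Relation.Nullary using (does; yes; no; contradiction)
open import Relation.Nullary.Decidable using (dec-true; dec-false)

sumᶠ-cong : ∀ {n} {f g : Fin n → ℕ} → (∀ i → f i ≡ g i) → sumᶠ f ≡ sumᶠ g
sumᶠ-cong {zero}  f≗g = refl
sumᶠ-cong {suc n} f≗g = cong₂ _+_ (f≗g zero) (sumᶠ-cong (f≗g ∘ suc))

sumᶠ-+ : ∀ {n} (f g : Fin n → ℕ) → sumᶠ (λ i → f i + g i) ≡ sumᶠ f + sumᶠ g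
sumᶠ-+ {zero}  f g = refl
sumᶠ-+ {suc n} f g =
  trans (cong (f zero + g zero +_) (sumᶠ-+ (f ∘ suc) (g ∘ suc)))
        (interchange +-commutativeSemigroup (f zero) (g zero) _ _)

sumᶠ-zero : ∀ {n} → sumᶠ {n} (λ _ → 0) ≡ 0
sumᶠ-zero {zero}  = refl
sumᶠ-zero {suc n} = sumᶠ-zero {n}

sumᶠ-indicator : ∀ {n} (k : Fin n) c → sumᶠ (λ i → if does (i ≟ k) then c else 0) ≡ c
sumᶠ-indicator {suc n} zero    c = trans (cong (c +_) (sumᶠ-zero {n})) (+-identityʳ c)
sumᶠ-indicator {suc n} (suc k) c = sumᶠ-indicator k c

term≤sumᶠ : ∀ {n} (g : Fin n → ℕ) k → g k ≤ sumᶠ g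
term≤sumᶠ g zero    = m≤m+n _ _
term≤sumᶠ g (suc k) = ≤-trans (term≤sumᶠ (g ∘ suc) k) (m≤n+m _ _)

two-terms≤sumᶠ : ∀ {n} (g : Fin n → ℕ) i k → i ≢ k → g i + g k ≤ sumᶠ g
two-terms≤sumᶠ g zero    zero    i≢k = contradiction refl i≢k
two-terms≤sumᶠ g zero    (suc k) _   = +-monoʳ-≤ (g zero) (term≤sumᶠ (g ∘ suc) k)
two-terms≤sumᶠ g (suc i) zero    _   =
  subst (_≤ sumᶠ g) (+-comm (g zero) (g (suc i))) (+-monoʳ-≤ (g zero) (term≤sumᶠ (g ∘ suc) i))
two-terms≤sumᶠ g (suc i) (suc k) i≢k =
  ≤-trans (two-terms≤sumᶠ (g ∘ suc) i k (i≢k ∘ cong suc)) (m≤n+m _ _)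

countᶠ-const : ∀ {n} b → countᶠ {n} (λ _ → b) ≡ (if b then n else 0)
countᶠ-const {zero}  true  = refl
countᶠ-const {suc n} true  = cong suc (countᶠ-const true)
countᶠ-const {n}     false = sumᶠ-zero {n}

countᶠ-mono : ∀ {n} {p q : Fin n → Bool} → (∀ i → p i ≡ true → q i ≡ true) → countᶠ p ≤ countᶠ q
countᶠ-mono {zero}          p⊆q = z≤n
countᶠ-mono {suc n} {p} {q} p⊆q with p zero in p₀
... | true  rewrite p⊆q zero p₀ = s≤s (countᶠ-mono (p⊆q ∘ suc))
... | false = ≤-trans (countᶠ-mono (p⊆q ∘ suc)) (m≤n+m _ _)

countᶠ-∨ : ∀ {n} {p q : Fin n → Bool} → (∀ i → p i ≡ true → q i ≡ false) →
           countᶠ (λ i → p i ∨ q i) ≡ countᶠ p + countᶠ q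
countᶠ-∨ {zero}          disj = refl
countᶠ-∨ {suc n} {p} {q} disj with p zero in p₀ | q zero in q₀
... | true  | true  = contradiction (trans (sym q₀) (disj zero p₀)) λ ()
... | true  | false = cong suc (countᶠ-∨ (disj ∘ suc))
... | false | true  = trans (cong suc (countᶠ-∨ (disj ∘ suc))) (sym (+-suc _ _))
... | false | false = countᶠ-∨ (disj ∘ suc)

allᶠ⁻ : ∀ {n} {p : Fin n → Bool} → allᶠ p ≡ true → ∀ i → p i ≡ true
allᶠ⁻ {suc n} {p} all-p i with p zero in p₀
allᶠ⁻ {suc n} {p} all-p zero    | true = p₀
allᶠ⁻ {suc n} {p} all-p (suc i) | true = allᶠ⁻ all-p i

allᶠ⁺ : ∀ {n} {p : Fin n → Bool} → (∀ i → p i ≡ true) → allᶠ p ≡ true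
allᶠ⁺ {zero}      all-p = refl
allᶠ⁺ {suc n} {p} all-p rewrite all-p zero = allᶠ⁺ (all-p ∘ suc)

Agrees : ∀ {N m s v} → Array N m s v → RTSubset m s → (Fin m → Fin s → Fin v) → Fin N → Set
Agrees A J f r = ∀ i j → J i j ≡ true → A r i j ≡ f i j

agreesOn⇒Agrees : ∀ {N m s v} (A : Array N m s v) J f r → agreesOn A J f r ≡ true → Agrees A J f r
agreesOn⇒Agrees A J f r agree i j j∈J with allᶠ⁻ (allᶠ⁻ agree i) j
... | entry rewrite j∈J with A r i j ≟ f i j
...   | yes eq = eq

Agrees⇒agreesOn : ∀ {N m s v} (A : Array N m s v) J f r → Agrees A J f r → agreesOn A J f r ≡ true
Agrees⇒agreesOn A J f r agree = allᶠ⁺ λ i → allᶠ⁺ λ j → entry i j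
  where
  entry : ∀ i j → not (J i j) ∨ does (A r i j ≟ f i j) ≡ true
  entry i j with J i j in j∈J
  ... | false = refl
  ... | true  = dec-true (A r i j ≟ f i j) (agree i j j∈J)

CoveringWindow : ∀ {N m s m′ s′ v} → ℕ → Array N m s v → Array N m′ s′ v →
                 RTSubset m′ s′ → (Fin m′ → Fin s′ → Fin v) → Set
CoveringWindow {m = m} {s} {v = v} t A B J′ f′ =
  Σ[ J ∈ RTSubset m s ] IsAntiIdeal J × card J ≡ t ×
  Σ[ f ∈ (Fin m → Fin s → Fin v) ] (∀ r → Agrees A J f r → Agrees B J′ f′ r)

CoveredBy : ∀ {N m s m′ s′ v} → ℕ → Array N m′ s′ v → Array N m s v → Set
CoveredBy {m′ = m′} {s′} {v} t B A =
  (J′ : RTSubset m′ s′) → IsAntiIdeal J′ → card J′ ≡ t → (f′ : Fin m′ → Fin s′ → Fin v) →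
  CoveringWindow t A B J′ f′

IsOCA-covered : ∀ {λ′ N t m s m′ s′ v} {A : Array N m s v} {B : Array N m′ s′ v} →
                CoveredBy t B A → IsOCA λ′ N t m s v A → IsOCA λ′ N t m′ s′ v B
IsOCA-covered {A = A} {B} cover oca J′ anti card≡t f′ with cover J′ anti card≡t f′
... | J , antiJ , cardJ≡t , f , agree =
  ≤-trans (oca J antiJ cardJ≡t f)
          (countᶠ-mono λ r → Agrees⇒agreesOn B J′ f′ r ∘ agree r ∘ agreesOn⇒Agrees A J f r)

dropBottom : ∀ {N m s v} → Array N m (suc s) v → Array N m s v
dropBottom A r i j = A r i (suc j)

dropBlock : ∀ {N m s v} → Array N (suc m) s v → Array N m s v
dropBlock A r i = A r (suc i)

raise : ∀ {m s} → RTSubset m s → RTSubset m (suc s)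
raise J i zero    = false
raise J i (suc j) = J i j

lower : ∀ {m s} → RTSubset m (suc s) → RTSubset m s
lower J i j = J i (suc j)

raiseBlock : ∀ {m s} → RTSubset m s → RTSubset (suc m) s
raiseBlock J zero    j = false
raiseBlock J (suc i) j = J i j

raise-antiIdeal : ∀ {m s} {J : RTSubset m s} → IsAntiIdeal J → IsAntiIdeal (raise J)
raise-antiIdeal anti i zero    k       j≤k       ()
raise-antiIdeal anti i (suc j) (suc k) (s≤s j≤k) j∈J = anti i j k j≤k j∈J

lower-antiIdeal : ∀ {m s} {J : RTSubset m (suc s)} → IsAntiIdeal J → IsAntiIdeal (lower J)
lower-antiIdeal anti i j k j≤k = anti i (suc j) (suc k) (s≤s j≤k)

raiseBlock-antiIdeal : ∀ {m s} {J : RTSubset m s} → IsAntiIdeal J → IsAntiIdeal (raiseBlock J)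
raiseBlock-antiIdeal anti zero    j k j≤k ()
raiseBlock-antiIdeal anti (suc i) j k j≤k j∈J = anti i j k j≤k j∈J

card-lower : ∀ {m s} {J : RTSubset m (suc s)} → (∀ i → J i zero ≡ false) → card (lower J) ≡ card J
card-lower {J = J} no-bottom = sumᶠ-cong λ i → cong (λ b → (if b then 1 else 0) + countᶠ (lower J i)) (sym (no-bottom i))

card-raiseBlock : ∀ {m s} (J : RTSubset m s) → card (raiseBlock J) ≡ card J
card-raiseBlock {s = s} J = cong (_+ card J) (countᶠ-const {s} false)

dropBottom-covered : ∀ {N m s v} (A : Array N m (suc (suc s)) v) t → CoveredBy t (dropBottom A) A
dropBottom-covered A t J′ anti card≡t f′ =
  raise J′ , raise-antiIdeal anti , card≡t ,
  (λ { i zero → f′ i zero ; i (suc j) → f′ i j }) , λ r agree i j → agree i (suc j)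

dropBlock-covered : ∀ {N m s v} (A : Array N (suc (suc m)) s v) t → CoveredBy t (dropBlock A) A
dropBlock-covered A t J′ anti card≡t f′ =
  raiseBlock J′ , raiseBlock-antiIdeal anti , trans (card-raiseBlock J′) card≡t ,
  (λ { zero → f′ zero ; (suc i) → f′ i }) , λ r agree i → agree (suc i)

block : ∀ {m s} → Fin m → RTSubset m s
block a i j = does (i ≟ a)

point : ∀ {m s} → Fin m → Fin s → RTSubset m s
point a b i j = does (i ≟ a) ∧ does (j ≟ b)

_∪_ : ∀ {m s} → RTSubset m s → RTSubset m s → RTSubset m s
(J ∪ K) i j = J i j ∨ K i j

block-member : ∀ {m s} {a i : Fin m} {j : Fin s} → block a i j ≡ true → i ≡ a
block-member {a = a} {i} i∈a with i ≟ a
... | yes i≡a = i≡a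

point-self : ∀ {m s} (a : Fin m) (b : Fin s) → point a b a b ≡ true
point-self a b = cong₂ _∧_ (dec-true (a ≟ a) refl) (dec-true (b ≟ b) refl)

point-≢ : ∀ {m s} {a i : Fin m} (b j : Fin s) → i ≢ a → point a b i j ≡ false
point-≢ {a = a} {i} b j i≢a = cong (_∧ does (j ≟ b)) (dec-false (i ≟ a) i≢a)

block-antiIdeal : ∀ {m s} (a : Fin m) → IsAntiIdeal (block {s = s} a)
block-antiIdeal a i j k j≤k i∈a = i∈a

top-point-antiIdeal : ∀ {m s} (a : Fin m) → IsAntiIdeal (point a (fromℕ s))
top-point-antiIdeal {s = s} a i j k j≤k j∈J with j ≟ fromℕ s
... | yes refl rewrite Fin.≤-antisym (≤fromℕ k) j≤k =
  trans (cong (does (i ≟ a) ∧_) (dec-true (fromℕ s ≟ fromℕ s) refl)) j∈J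
... | no _ = contradiction (trans (sym (Bool.∧-zeroʳ _)) j∈J) λ ()

∪-antiIdeal : ∀ {m s} {J K : RTSubset m s} → IsAntiIdeal J → IsAntiIdeal K → IsAntiIdeal (J ∪ K)
∪-antiIdeal {J = J} {K} antiJ antiK i j k j≤k j∈J∪K with J i j in j∈J | K i j in j∈K
... | true  | _    = cong (_∨ K i k) (antiJ i j k j≤k j∈J)
... | false | true = trans (cong (J i k ∨_) (antiK i j k j≤k j∈K)) (Bool.∨-zeroʳ _)

card-∪ : ∀ {m s} {J K : RTSubset m s} → (∀ i j → J i j ≡ true → K i j ≡ false) →
         card (J ∪ K) ≡ card J + card K
card-∪ {J = J} {K} disj =
  trans (sumᶠ-cong λ i → countᶠ-∨ (disj i)) (sumᶠ-+ (countᶠ ∘ J) (countᶠ ∘ K))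

card-block : ∀ {m s} (a : Fin m) → card (block {s = s} a) ≡ s
card-block {s = s} a = trans (sumᶠ-cong λ i → countᶠ-const {s} (does (i ≟ a))) (sumᶠ-indicator a s)

card-point : ∀ {m s} (a : Fin m) (b : Fin s) → card (point a b) ≡ 1
card-point {s = s} a b = trans (sumᶠ-cong row) (sumᶠ-indicator a 1)
  where
  row : ∀ i → countᶠ (point a b i) ≡ (if does (i ≟ a) then 1 else 0)
  row i with does (i ≟ a)
  ... | true  = sumᶠ-indicator b 1
  ... | false = countᶠ-const {s} false

-- By up-closure J contains the whole chain a, so it has no room for anything else.
antiIdeal-⊆-block : ∀ {m s} {J : RTSubset m (suc s)} {a : Fin m} → IsAntiIdeal J → card J ≡ suc s →
                    J a zero ≡ true → ∀ i j → J i j ≡ true → i ≡ a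
antiIdeal-⊆-block {s = s} {J} {a} anti card≡ a₀∈J i j j∈J with i ≟ a
... | yes i≡a = i≡a
... | no  i≢a = contradiction too-many 1+n≰n
  where
  row-a-full : suc s ≤ countᶠ (J a)
  row-a-full = subst (_≤ countᶠ (J a)) (countᶠ-const {suc s} true)
                     (countᶠ-mono {p = λ _ → true} λ k _ → anti a zero k z≤n a₀∈J)
  row-i-nonempty : 1 ≤ countᶠ (J i)
  row-i-nonempty = subst (λ b → (if b then 1 else 0) ≤ countᶠ (J i)) j∈J
                         (term≤sumᶠ (λ k → if J i k then 1 else 0) j)
  too-many : suc (suc s) ≤ suc s
  too-many = ≤-trans (+-mono-≤ row-i-nonempty row-a-full)
                     (≤-trans (two-terms≤sumᶠ (countᶠ ∘ J) i a i≢a) (≤-reflexive card≡))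

other : ∀ {m} → Fin (suc (suc m)) → Fin (suc (suc m))
other zero    = suc zero
other (suc _) = zero

other-≢ : ∀ {m} (i : Fin (suc (suc m))) → other i ≢ i
other-≢ zero    ()
other-≢ (suc i) ()

extendChains : ∀ {N m s v} → Array N (suc (suc m)) (suc s) v → Array N (suc (suc m)) (suc (suc s)) v
extendChains {s = s} A r i zero    = A r (other i) (fromℕ s)
extendChains         A r i (suc j) = A r i j

lower-window : ∀ {N m s v t} (A : Array N (suc (suc m)) (suc s) v) {J′ f′} →
               IsAntiIdeal J′ → card J′ ≡ t → (∀ i → J′ i zero ≡ false) →
               CoveringWindow t A (extendChains A) J′ f′
lower-window A {J′} {f′} anti card≡t no-bottom =
  lower J′ , lower-antiIdeal anti , trans (card-lower {J = J′} no-bottom) card≡t ,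
  (λ i j → f′ i (suc j)) , agree
  where
  agree : ∀ r → Agrees A (lower J′) (λ i j → f′ i (suc j)) r → Agrees (extendChains A) J′ f′ r
  agree r h i zero    i₀∈J′ = contradiction (trans (sym (no-bottom i)) i₀∈J′) λ ()
  agree r h i (suc j) j∈J′  = h i j j∈J′

chain-window : ∀ {N m s v} (A : Array N (suc (suc m)) (suc s) v) {J′ f′ a} →
               IsAntiIdeal J′ → card J′ ≡ suc (suc s) → J′ a zero ≡ true →
               CoveringWindow (suc (suc s)) A (extendChains A) J′ f′
chain-window {s = s} A {J′} {f′} {a} anti card≡ a₀∈J′ =
  J , ∪-antiIdeal (block-antiIdeal a) (top-point-antiIdeal b) , card-J , f , agree
  where
  b = other a
  ⊤ = fromℕ s

  J : RTSubset _ (suc s)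
  J = block a ∪ point b ⊤

  f : Fin _ → Fin (suc s) → Fin _
  f i j = if point b ⊤ i j then f′ a zero else f′ i (suc j)

  disjoint : ∀ i j → block a i j ≡ true → point b ⊤ i j ≡ false
  disjoint i j i∈a = point-≢ ⊤ j λ i≡b → other-≢ a (trans (sym i≡b) (block-member {i = i} {j = j} i∈a))

  card-J : card J ≡ suc (suc s)
  card-J = trans (card-∪ disjoint) (trans (cong₂ _+_ (card-block {s = suc s} a) (card-point b ⊤)) (+-comm (suc s) 1))

  agree : ∀ r → Agrees A J f r → Agrees (extendChains A) J′ f′ r
  agree r h i j j∈J′ rewrite antiIdeal-⊆-block anti card≡ a₀∈J′ i j j∈J′ = on-chain j
    where
    on-chain : ∀ j → extendChains A r a j ≡ f′ a j
    on-chain zero    = trans (h b ⊤ (trans (cong (block a b ⊤ ∨_) (point-self b ⊤)) (Bool.∨-zeroʳ _)))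
                             (cong (λ c → if c then f′ a zero else f′ b (suc ⊤)) (point-self b ⊤))
    on-chain (suc j) = trans (h a j (cong (_∨ point b ⊤ a j) (dec-true (a ≟ a) refl)))
                             (cong (λ c → if c then f′ a zero else f′ a (suc j)) (point-≢ ⊤ j (other-≢ a ∘ sym)))

extendChains-covered : ∀ {N m s v} (A : Array N (suc (suc m)) (suc s) v) →
                       CoveredBy (suc (suc s)) (extendChains A) A
extendChains-covered A J′ anti card≡ f′ with any? (λ i → J′ i zero Bool.≟ true)
... | yes (a , a₀∈J′) = chain-window A anti card≡ a₀∈J′
... | no  no-bottom   = lower-window A anti card≡ λ i → Bool.¬-not λ i₀∈J′ → no-bottom (i , i₀∈J′)

proposition2 : (N t m s v λ' : ℕ) → 1 ≤ N → 1 ≤ t → 1 ≤ m → 1 ≤ s → 1 ≤ v → 1 ≤ λ' →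
    ((2 ≤ t → t ≤ m * (t ∸ 1) → OCA λ' N t m (t ∸ 1) v → OCA λ' N t m t v)
    × (2 ≤ s → 2 ≤ t → t ≤ m * (s ∸ 1) → OCA λ' N t m s v → OCA λ' N t m (s ∸ 1) v)
    × (2 ≤ m → 2 ≤ t → t ≤ (m ∸ 1) * s → OCA λ' N t m s v → OCA λ' N t (m ∸ 1) s v))
proposition2 N t m s v λ' _ _ _ _ _ _ = part₁ t m , part₂ , part₃
  where
  part₁ : ∀ t m → 2 ≤ t → t ≤ m * (t ∸ 1) → OCA λ' N t m (t ∸ 1) v → OCA λ' N t m t v
  part₁ (suc zero)    _             (s≤s ())
  part₁ (suc (suc k)) zero          _   ()
  part₁ (suc (suc k)) (suc zero)    _   t≤m*k _ =
    contradiction (≤-trans t≤m*k (≤-reflexive (*-identityˡ (suc k)))) 1+n≰n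
  part₁ (suc (suc k)) (suc (suc m)) 2≤t t≤m*k (_ , _ , A , oca) =
    2≤t , ≤-trans t≤m*k (*-monoʳ-≤ (suc (suc m)) (n≤1+n (suc k))) ,
    extendChains A , IsOCA-covered (extendChains-covered A) oca

  part₂ : 2 ≤ s → 2 ≤ t → t ≤ m * (s ∸ 1) → OCA λ' N t m s v → OCA λ' N t m (s ∸ 1) v
  part₂ (s≤s (s≤s _)) 2≤t t≤ms (_ , _ , A , oca) =
    2≤t , t≤ms , dropBottom A , IsOCA-covered (dropBottom-covered A t) oca

  part₃ : 2 ≤ m → 2 ≤ t → t ≤ (m ∸ 1) * s → OCA λ' N t m s v → OCA λ' N t (m ∸ 1) s v
  part₃ (s≤s (s≤s _)) 2≤t t≤ms (_ , _ , A , oca) =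
    2≤t , t≤ms , dropBlock A , IsOCA-covered (dropBlock-covered A t) oca
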